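{- Let $q$ be a prime power and $n,k,t$ positive integers with $2\le k\le n-1$, and let $\mathcal{D}$ be the Desarguesian $(t-1)$-spread of $\mathrm{PG}(nt-1,q)$. Let $\Pi$ be an $(nt-kt+1)$-dimensional subspace of $\mathrm{PG}(nt-1,q)$ and let $P$ be a point of $\Pi$; denote by $\mathcal{B}(P)$ the element of $\mathcal{D}$ containing $P$. Then there exists a $\mathcal{D}_{k-2}$-subspace meeting $\Pi$ only in points of $\mathcal{B}(P)$. Moreover, if $\mathcal{B}(P)\cap\Pi$ has dimension at least $1$, then there exists a $\mathcal{D}_{k-1}$-subspace meeting $\Pi$ only in points of $\mathcal{B}(P)$.
   Context: Field reduction: each point of $\mathrm{PG}(n-1,q^t)$ corresponds to a $(t-1)$-dimensional subspace of $\mathrm{PG}(nt-1,q)$ (via $\mathbb{F}_{q^t}^n\cong\mathbb{F}_q^{nt}$); these form the Desarguesian spread $\mathcal{D}$. A $\mathcal{D}_{r-1}$-subspace is the $(rt-1)$-dimensional subspace spanned by the elements of $\mathcal{D}$ corresponding to the points of an $(r-1)$-dimensional subspace of $\mathrm{PG}(n-1,q^t)$. -}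

module Defs where

open import Level using (Level; _⊔_)
open import Data.Nat using (ℕ; suc; _^_; _≤_)
open import Data.Nat.Primality using (Prime)
open import Data.Fin using (Fin; zero; suc)
open import Data.Product using (Σ; ∃; _×_; _,_)
open import Relation.Binary.PropositionalEquality using (_≡_)
open import Relation.Nullary using (¬_)
open import Data.Unit using (⊤)
open import Algebra.Bundles using (CommutativeRing)

IsPrimePower : ℕ → Set
IsPrimePower q = Σ ℕ λ p → Σ ℕ λ e → Prime p × 1 ≤ e × q ≡ p ^ e

module FieldReduction {c ℓ : Level} (F : CommutativeRing c ℓ) where
  open CommutativeRing F hiding (zero)

  IsField : Set (c ⊔ ℓ)
  IsField = (¬ (1# ≈ 0#)) × (∀ x → ¬ (x ≈ 0#) → Σ Carrier λ y → x * y ≈ 1#)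

  HasSize : ∀ {p} → (Carrier → Set p) → ℕ → Set (c ⊔ ℓ ⊔ p)
  HasSize P m = Σ (Fin m → Carrier) λ xs →
      (∀ i → P (xs i))
    × (∀ i j → xs i ≈ xs j → i ≡ j)
    × (∀ x → P x → Σ (Fin m) λ i → x ≈ xs i)

  IsSubfield : ∀ {p} → (Carrier → Set p) → Set (c ⊔ ℓ ⊔ p)
  IsSubfield K =
      (∀ x y → x ≈ y → K x → K y)
    × K 0# × K 1#
    × (∀ x y → K x → K y → K (x + y))
    × (∀ x → K x → K (- x))
    × (∀ x y → K x → K y → K (x * y))
    × (∀ x y → K x → x * y ≈ 1# → K y)

  Σ[_] : ∀ {m} → (Fin m → Carrier) → Carrier
  Σ[_] {0} f = 0#
  Σ[_] {suc m} f = f zero + Σ[ (λ i → f (suc i)) ]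

  -- vectors of F^n  (F^n ≅ 𝔽_q^{nt} via field reduction)
  V : ℕ → Set c
  V n = Fin n → Carrier

  _≈ᵥ_ : ∀ {n} → V n → V n → Set ℓ
  u ≈ᵥ w = ∀ j → u j ≈ w j

  0ᵥ : ∀ {n} → V n
  0ᵥ j = 0#

  lc : ∀ {n m} → (Fin m → Carrier) → (Fin m → V n) → V n
  lc cs bs j = Σ[ (λ i → cs i * bs i j) ]

  -- span of the b_i with coefficients taken from the subset S of F
  -- (S = K gives the K-span, S = everything gives the F-span)
  module _ {p} (S : Carrier → Set p) where
    InSpan : ∀ {n m} → (Fin m → V n) → V n → Set (c ⊔ ℓ ⊔ p)
    InSpan {n} {m} bs w = Σ (Fin m → Carrier) λ cs → (∀ i → S (cs i)) × (w ≈ᵥ lc cs bs)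
    Independent : ∀ {n m} → (Fin m → V n) → Set (c ⊔ ℓ ⊔ p)
    Independent bs = ∀ cs → (∀ i → S (cs i)) → lc cs bs ≈ᵥ 0ᵥ → ∀ i → cs i ≈ 0#

  AllF : Carrier → Set
  AllF _ = ⊤

  -- the element B(v) of the Desarguesian spread containing the point ⟨v⟩:
  -- w ∈ B(v)  iff  w = λ v for some λ ∈ F
  InSpreadElt : ∀ {n} → V n → V n → Set (c ⊔ ℓ)
  InSpreadElt v w = Σ Carrier λ λ' → w ≈ᵥ (λ j → λ' * v j)

  -- a D_{r-1}-subspace: spanned by the spread elements of the points of an
  -- (r-1)-dim subspace ⟨b_0,…,b_{r-1}⟩_F of PG(n-1,q^t); as a point set this is
  -- the F-span of the F-independent b_i.
  IsDBasis : ∀ {n} (r : ℕ) → (Fin r → V n) → Set (c ⊔ ℓ)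
  IsDBasis r bs = Independent AllF bs

-- Model: F = 𝔽_{q^t} ⊇ K = 𝔽_q; points of PG(nt-1,q) are K-lines of F^n, the spread
-- element B(P) of P = ⟨v⟩ is the F-line F·v, a D_{r-1}-subspace is the F-span of r
-- F-independent vectors, and Π is the K-span of N + 2 vectors, N = nt - kt.
--
-- By Steinitz exchange, v (resp. a K-basis u₀, u₁ of a line of Π inside B(P))
-- replaces generators of Π, so that Π ⊆ ⟨g⟩_K + B(P) for a K-family g of N + 1
-- (resp. N) vectors.  Starting from b = (v), an F-independent family b with
-- v ∈ ⟨b⟩_F and ⟨b⟩_F ∩ Π ⊆ B(P) can be extended by any x outside the cone
-- F·(⟨g⟩_K + ⟨b⟩_F); such an x exists by counting, the cone being the image of a
-- non-injective map from a set of size q^t · q^{|g|} · q^{t|b|} ≤ q^{tn} = |F^n|.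
-- This budget allows k - 1 (resp. k) vectors.

module Submission where

open import Data.Nat as ℕ using (ℕ; zero; suc; z≤n; s≤s)
open import Data.Nat.Properties as ℕP using ()
open import Data.Nat.Solver using (module +-*-Solver)
open import Data.Fin as Fin using (Fin; zero; suc; punchIn; punchOut)
open import Data.Fin.Properties as FinP using (any?; ¬∀⟶∃¬; injective⇒≤; punchIn-punchOut)
open import Data.Product using (Σ; ∃; _×_; _,_; proj₁; proj₂; uncurry)
open import Function using (_∘_)
open import Relation.Binary.PropositionalEquality as ≡ using (_≡_; _≢_)
open import Relation.Nullary using (¬_; Dec; yes; no)
open import Data.Empty using (⊥-elim)
open import Level using (Level; _⊔_)
open import Data.Unit using (tt)
open import Data.Vec.Functional using (_∷_; []; removeAt)
open import Algebra.Bundles using (CommutativeRing)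
open import Defs

module Counting where
  open import Data.Nat using (_<_; _≤_)

  missesPoint : ∀ {A B} → A < B → (h : Fin A → Fin B) → ∃ λ y → ∀ a → h a ≢ y
  missesPoint {A} {B} A<B h
    with ¬∀⟶∃¬ B (λ y → ∃ λ a → h a ≡ y) (λ y → any? (λ a → h a FinP.≟ y)) notOnto
    where
    -- a surjection would have an injective section Fin B → Fin A
    notOnto : ¬ (∀ y → ∃ λ a → h a ≡ y)
    notOnto onto = ℕP.<⇒≱ A<B (injective⇒≤ section-injective)
      where
      section-injective : ∀ {y y′} → proj₁ (onto y) ≡ proj₁ (onto y′) → y ≡ y′
      section-injective {y} {y′} e =
        ≡.trans (≡.sym (proj₂ (onto y))) (≡.trans (≡.cong h e) (proj₂ (onto y′)))
  ... | y , unreached = y , λ a e → unreached (a , e)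

  -- If a map Fin A → Fin B with A ≤ B identifies two points, then its restriction
  -- to the complement of one of them already misses a point, and so does the map.
  collision⇒missesPoint : ∀ {A B} (h : Fin A → Fin B) {i j : Fin A} →
    i ≢ j → h i ≡ h j → A ≤ B → ∃ λ y → ∀ a → h a ≢ y
  collision⇒missesPoint {suc A} h {i} {j} i≢j hi≡hj A≤B
    with y , missed ← missesPoint A≤B (h ∘ punchIn i) = y , unreached
    where
    unreached : ∀ a → h a ≢ y
    unreached a ha≡y with a FinP.≟ i
    ... | yes ≡.refl = missed (punchOut i≢j)
                       (≡.trans (≡.cong h (punchIn-punchOut i≢j)) (≡.trans (≡.sym hi≡hj) ha≡y))
    ... | no a≢i   = missed (punchOut (a≢i ∘ ≡.sym))
                       (≡.trans (≡.cong h (punchIn-punchOut (a≢i ∘ ≡.sym))) ha≡y)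

  funToFin-cong : ∀ {m n} {f g : Fin m → Fin n} → (∀ i → f i ≡ g i) → Fin.funToFin f ≡ Fin.funToFin g
  funToFin-cong {zero}  f≗g = ≡.refl
  funToFin-cong {suc m} f≗g = ≡.cong₂ Fin.combine (f≗g zero) (funToFin-cong (f≗g ∘ suc))

module Arithmetic where
  open import Data.Nat using (_+_; _*_; _^_; _≤_)

  powerBound : ∀ q t m s n → 1 ≤ q → t + (m + t * s) ≤ t * n →
    q ^ t * (q ^ m * (q ^ t) ^ s) ≤ (q ^ t) ^ n
  powerBound (suc q) t m s n _ exponents = begin
    Q * (q′ ^ m * Q ^ s)         ≡⟨ ≡.cong (λ z → Q * (q′ ^ m * z)) (ℕP.^-*-assoc q′ t s) ⟩
    Q * (q′ ^ m * q′ ^ (t * s))  ≡⟨ ≡.cong (Q *_) (ℕP.^-distribˡ-+-* q′ m (t * s)) ⟨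
    Q * q′ ^ (m + t * s)         ≡⟨ ℕP.^-distribˡ-+-* q′ t (m + t * s) ⟨
    q′ ^ (t + (m + t * s))       ≤⟨ ℕP.^-monoʳ-≤ q′ exponents ⟩
    q′ ^ (t * n)                 ≡⟨ ℕP.^-*-assoc q′ t n ⟨
    Q ^ n                        ∎
    where
    open ℕP.≤-Reasoning
    q′ = suc q
    Q = q′ ^ t

  budget : ∀ t n j N → N + suc j * t ≡ n * t → t + (N + t * j) ≡ t * n
  budget t n j N total = begin
    t + (N + t * j)  ≡⟨ rearrange t N j ⟩
    N + suc j * t    ≡⟨ total ⟩
    n * t            ≡⟨ ℕP.*-comm n t ⟩
    t * n            ∎
    where
    open ≡.≡-Reasoning
    open +-*-Solver
    rearrange : ∀ t N j → t + (N + t * j) ≡ N + suc j * t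
    rearrange = solve 3 (λ t N j → t :+ (N :+ t :* j) := N :+ (con 1 :+ j) :* t) ≡.refl

  -- Trading one factor q^t for a single extra factor q costs nothing when t ≥ 1.
  budget-shift : ∀ t N j → 1 ≤ t → t + (suc N + t * j) ≤ t + (N + t * suc j)
  budget-shift t N j 1≤t = ℕP.+-monoʳ-≤ t (begin
    suc N + t * j    ≡⟨ ℕP.+-suc N (t * j) ⟨
    N + suc (t * j)  ≤⟨ ℕP.+-monoʳ-≤ N (ℕP.+-monoˡ-≤ (t * j) 1≤t) ⟩
    N + (t + t * j)  ≡⟨ ≡.cong (N +_) (ℕP.*-suc t j) ⟨
    N + t * suc j    ∎)
    where open ℕP.≤-Reasoning

open Counting
open Arithmetic

module LinearAlgebra {c ℓ : Level} (F : CommutativeRing c ℓ) where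
  open CommutativeRing F hiding (zero)
  open FieldReduction F
  open import Algebra.Properties.Semiring.Sum semiring
    using (sum; sum-cong-≋; ∑-distrib-+; *-distribˡ-sum; sum-remove; sum-replicate-zero)
  open import Algebra.Properties.Ring ring using (-1*x≈-x; -‿distribˡ-*)
  open import Algebra.Properties.Group +-group using (//-rightDividesʳ)
  open import Data.Vec.Functional.Relation.Binary.Equality.Setoid setoid
    using (≋-refl; ≋-sym; ≋-trans)
  open import Relation.Binary.Reasoning.Setoid setoid

  infixl 26 _⊕_ _⊖_
  infixr 27 _⊙_

  _⊕_ _⊖_ : ∀ {n} → V n → V n → V n
  (u ⊕ w) j = u j + w j
  (u ⊖ w) j = u j - w j

  _⊙_ : ∀ {n} → Carrier → V n → V n
  (a ⊙ u) j = a * u j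

  Σ≡sum : ∀ {m} (f : Fin m → Carrier) → Σ[ f ] ≡ sum f
  Σ≡sum {zero}  f = ≡.refl
  Σ≡sum {suc m} f = ≡.cong (f zero +_) (Σ≡sum (f ∘ suc))

  lc≡sum : ∀ {n m} (cs : Fin m → Carrier) (bs : Fin m → V n) j → lc cs bs j ≡ sum (λ i → cs i * bs i j)
  lc≡sum cs bs j = Σ≡sum (λ i → cs i * bs i j)

  lc-cong : ∀ {n m} {cs ds : Fin m → Carrier} (bs : Fin m → V n) →
    (∀ i → cs i ≈ ds i) → lc cs bs ≈ᵥ lc ds bs
  lc-cong {cs = cs} {ds} bs cs≈ds j = begin
    lc cs bs j                  ≡⟨ lc≡sum cs bs j ⟩
    sum (λ i → cs i * bs i j)   ≈⟨ sum-cong-≋ (λ i → *-congʳ (cs≈ds i)) ⟩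
    sum (λ i → ds i * bs i j)   ≡⟨ lc≡sum ds bs j ⟨
    lc ds bs j                  ∎

  lc-+ : ∀ {n m} (cs ds : Fin m → Carrier) (bs : Fin m → V n) →
    lc (λ i → cs i + ds i) bs ≈ᵥ lc cs bs ⊕ lc ds bs
  lc-+ cs ds bs j = begin
    lc (λ i → cs i + ds i) bs j                          ≡⟨ lc≡sum _ bs j ⟩
    sum (λ i → (cs i + ds i) * bs i j)                   ≈⟨ sum-cong-≋ (λ i → distribʳ (bs i j) (cs i) (ds i)) ⟩
    sum (λ i → cs i * bs i j + ds i * bs i j)            ≈⟨ ∑-distrib-+ (λ i → cs i * bs i j) (λ i → ds i * bs i j) ⟩
    sum (λ i → cs i * bs i j) + sum (λ i → ds i * bs i j) ≡⟨ ≡.cong₂ _+_ (lc≡sum cs bs j) (lc≡sum ds bs j) ⟨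
    lc cs bs j + lc ds bs j                              ∎

  lc-⊙ : ∀ {n m} a (cs : Fin m → Carrier) (bs : Fin m → V n) →
    lc (λ i → a * cs i) bs ≈ᵥ a ⊙ lc cs bs
  lc-⊙ a cs bs j = begin
    lc (λ i → a * cs i) bs j              ≡⟨ lc≡sum _ bs j ⟩
    sum (λ i → (a * cs i) * bs i j)       ≈⟨ sum-cong-≋ (λ i → *-assoc a (cs i) (bs i j)) ⟩
    sum (λ i → a * (cs i * bs i j))       ≈⟨ *-distribˡ-sum a (λ i → cs i * bs i j) ⟨
    a * sum (λ i → cs i * bs i j)         ≡⟨ ≡.cong (a *_) (lc≡sum cs bs j) ⟨
    a * lc cs bs j                        ∎

  lc-zero : ∀ {n m} (cs : Fin m → Carrier) (bs : Fin m → V n) →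
    (∀ i → cs i ≈ 0#) → lc cs bs ≈ᵥ 0ᵥ
  lc-zero {m = m} cs bs cs≈0 j = begin
    lc cs bs j                  ≡⟨ lc≡sum cs bs j ⟩
    sum (λ i → cs i * bs i j)   ≈⟨ sum-cong-≋ (λ i → trans (*-congʳ (cs≈0 i)) (zeroˡ (bs i j))) ⟩
    sum (λ (_ : Fin m) → 0#)    ≈⟨ sum-replicate-zero m ⟩
    0#                          ∎

  lc-removeAt : ∀ {n m} (i : Fin (suc m)) (cs : Fin (suc m) → Carrier) (bs : Fin (suc m) → V n) →
    lc cs bs ≈ᵥ cs i ⊙ bs i ⊕ lc (removeAt cs i) (removeAt bs i)
  lc-removeAt i cs bs j = begin
    lc cs bs j                                             ≡⟨ lc≡sum cs bs j ⟩
    sum (λ k → cs k * bs k j)                              ≈⟨ sum-remove (λ k → cs k * bs k j) ⟩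
    cs i * bs i j + sum (removeAt (λ k → cs k * bs k j) i)
      ≡⟨ ≡.cong (cs i * bs i j +_) (lc≡sum (removeAt cs i) (removeAt bs i) j) ⟨
    cs i * bs i j + lc (removeAt cs i) (removeAt bs i) j   ∎

  inv : IsField → ∀ a → ¬ (a ≈ 0#) → Carrier
  inv (_ , inverse) a a≉0 = proj₁ (inverse a a≉0)

  inv-left : (fld : IsField) → ∀ a (a≉0 : ¬ (a ≈ 0#)) → inv fld a a≉0 * a ≈ 1#
  inv-left (_ , inverse) a a≉0 = trans (*-comm _ a) (proj₂ (inverse a a≉0))

  isolate : ∀ {n} {ι a} {x y r : V n} → ι * a ≈ 1# → y ≈ᵥ a ⊙ x ⊕ r → x ≈ᵥ ι ⊙ (y ⊖ r)
  isolate {ι = ι} {a} {x} {y} {r} ιa≈1 y≈ax+r j = begin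
    x j                          ≈⟨ *-identityˡ (x j) ⟨
    1# * x j                     ≈⟨ *-congʳ ιa≈1 ⟨
    (ι * a) * x j                ≈⟨ *-assoc ι a (x j) ⟩
    ι * (a * x j)                ≈⟨ *-congˡ (//-rightDividesʳ (r j) (a * x j)) ⟨
    ι * ((a * x j + r j) - r j)  ≈⟨ *-congˡ (+-congʳ (y≈ax+r j)) ⟨
    ι * (y j - r j)              ∎

  SpanIncl : ∀ {p} (S : Carrier → Set p) {n m m′} → (Fin m → V n) → (Fin m′ → V n) → Set (c ⊔ ℓ ⊔ p)
  SpanIncl S bs bs′ = ∀ w → InSpan S bs w → InSpan S bs′ w

  span-subst : ∀ {p} {S : Carrier → Set p} {n m m′} (e : m ≡ m′) (bs : Fin m → V n) →
    SpanIncl S bs (≡.subst (λ k → Fin k → V n) e bs)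
  span-subst ≡.refl bs w w∈ = w∈

  allF-subfield : IsSubfield AllF
  allF-subfield = (λ _ _ _ _ → tt) , tt , tt , (λ _ _ _ _ → tt) , (λ _ _ → tt) , (λ _ _ _ _ → tt) , (λ _ _ _ _ → tt)

  module Spans {p} {S : Carrier → Set p} (sub : IsSubfield S) where
    private
      S-0 : S 0#
      S-0 = proj₁ (proj₂ sub)
      S-1 : S 1#
      S-1 = proj₁ (proj₂ (proj₂ sub))
      S-+ : ∀ {x y} → S x → S y → S (x + y)
      S-+ = proj₁ (proj₂ (proj₂ (proj₂ sub))) _ _
      S-neg : ∀ {x} → S x → S (- x)
      S-neg = proj₁ (proj₂ (proj₂ (proj₂ (proj₂ sub)))) _
      S-* : ∀ {x y} → S x → S y → S (x * y)
      S-* = proj₁ (proj₂ (proj₂ (proj₂ (proj₂ (proj₂ sub))))) _ _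
      S-inv : ∀ {x y} → S x → x * y ≈ 1# → S y
      S-inv = proj₂ (proj₂ (proj₂ (proj₂ (proj₂ (proj₂ sub))))) _ _

    module _ {n m} {bs : Fin m → V n} where
      span-cong : ∀ {u w} → u ≈ᵥ w → InSpan S bs u → InSpan S bs w
      span-cong u≈w (cs , Scs , u≈) = cs , Scs , ≋-trans (≋-sym u≈w) u≈

      span-zero : InSpan S bs 0ᵥ
      span-zero = (λ _ → 0#) , (λ _ → S-0) , ≋-sym (lc-zero (λ _ → 0#) bs (λ _ → refl))

      span-+ : ∀ {u w} → InSpan S bs u → InSpan S bs w → InSpan S bs (u ⊕ w)
      span-+ (cs , Scs , u≈) (ds , Sds , w≈) =
        (λ i → cs i + ds i) , (λ i → S-+ (Scs i) (Sds i)) ,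
        λ j → trans (+-cong (u≈ j) (w≈ j)) (sym (lc-+ cs ds bs j))

      span-⊙ : ∀ {a w} → S a → InSpan S bs w → InSpan S bs (a ⊙ w)
      span-⊙ {a} Sa (cs , Scs , w≈) =
        (λ i → a * cs i) , (λ i → S-* Sa (Scs i)) ,
        λ j → trans (*-congˡ (w≈ j)) (sym (lc-⊙ a cs bs j))

      span-⊖ : ∀ {u w} → InSpan S bs u → InSpan S bs w → InSpan S bs (u ⊖ w)
      span-⊖ u∈ w∈ = span-cong (λ j → +-congˡ (-1*x≈-x _)) (span-+ u∈ (span-⊙ (S-neg S-1) w∈))

    span-∷ : ∀ {n m} {bs : Fin m → V n} {x w} → InSpan S bs w → InSpan S (x ∷ bs) w
    span-∷ (cs , Scs , w≈) =
      (0# ∷ cs) , (λ { zero → S-0 ; (suc i) → Scs i }) ,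
      λ j → trans (w≈ j) (sym (trans (+-congʳ (zeroˡ _)) (+-identityˡ _)))

    span-generator : ∀ {n m} (bs : Fin m → V n) i → InSpan S bs (bs i)
    span-generator bs zero =
      (1# ∷ λ _ → 0#) , (λ { zero → S-1 ; (suc i) → S-0 }) ,
      λ j → sym (trans (+-cong (*-identityˡ _) (lc-zero (λ _ → 0#) (bs ∘ suc) (λ _ → refl) j)) (+-identityʳ _))
    span-generator bs (suc i) = span-∷ (span-generator (bs ∘ suc) i)

    span-trans : ∀ {n m m′} {gs : Fin m → V n} {hs : Fin m′ → V n} →
      (∀ i → InSpan S hs (gs i)) → SpanIncl S gs hs
    span-trans {m = zero}  {hs = hs} gs∈ w (cs , _ , w≈) = span-cong {bs = hs} (≋-sym w≈) span-zero
    span-trans {m = suc m} {hs = hs} gs∈ w (cs , Scs , w≈) =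
      span-cong {bs = hs} (≋-sym w≈)
        (span-+ (span-⊙ (Scs zero) (gs∈ zero))
                (span-trans (gs∈ ∘ suc) _ (cs ∘ suc , Scs ∘ suc , ≋-refl)))

    module _ (1≉0 : ¬ (1# ≈ 0#)) {n} (u : Fin 2 → V n) (independent : Independent S u) where
      independent-first≉0 : ¬ (u zero ≈ᵥ 0ᵥ)
      independent-first≉0 u₀≈0 = 1≉0 (independent cs Scs lc≈0 zero)
        where
        cs : Fin 2 → Carrier
        cs = 1# ∷ 0# ∷ []
        Scs : ∀ i → S (cs i)
        Scs = λ { zero → S-1 ; (suc zero) → S-0 }
        lc≈0 : lc cs u ≈ᵥ 0ᵥ
        lc≈0 j = begin
          1# * u zero j + (0# * u (suc zero) j + 0#) ≈⟨ +-cong (*-identityˡ _) (+-identityʳ _) ⟩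
          u zero j + 0# * u (suc zero) j            ≈⟨ +-cong (u₀≈0 j) (zeroˡ _) ⟩
          0# + 0#                                   ≈⟨ +-identityʳ 0# ⟩
          0#                                        ∎

      independent-notMultiple : ∀ {a} → S a → ¬ (u (suc zero) ≈ᵥ a ⊙ u zero)
      independent-notMultiple {a} Sa u₁≈au₀ = 1≉0 (independent cs Scs lc≈0 (suc zero))
        where
        cs : Fin 2 → Carrier
        cs = - a ∷ 1# ∷ []
        Scs : ∀ i → S (cs i)
        Scs = λ { zero → S-neg Sa ; (suc zero) → S-1 }
        lc≈0 : lc cs u ≈ᵥ 0ᵥ
        lc≈0 j = begin
          - a * u zero j + (1# * u (suc zero) j + 0#) ≈⟨ +-congˡ (trans (+-identityʳ _) (*-identityˡ _)) ⟩
          - a * u zero j + u (suc zero) j            ≈⟨ +-cong (sym (-‿distribˡ-* a (u zero j))) (u₁≈au₀ j) ⟩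
          - (a * u zero j) + a * u zero j            ≈⟨ -‿inverseˡ (a * u zero j) ⟩
          0#                                         ∎

    exchange : IsField → ∀ {n m} (gs : Fin (suc m) → V n) (cs : Fin (suc m) → Carrier) {u : V n} →
      (∀ i → S (cs i)) → u ≈ᵥ lc cs gs → ∀ i₀ → ¬ (cs i₀ ≈ 0#) →
      SpanIncl S gs (u ∷ removeAt gs i₀)
    exchange fld gs cs {u} Scs u≈ i₀ cᵢ₀≉0 = span-trans {gs = gs} {hs = hs} generator
      where
      ι = inv fld (cs i₀) cᵢ₀≉0
      ιc≈1 : ι * cs i₀ ≈ 1#
      ιc≈1 = inv-left fld (cs i₀) cᵢ₀≉0
      Sι : S ι
      Sι = S-inv (Scs i₀) (trans (*-comm (cs i₀) ι) ιc≈1)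
      hs = u ∷ removeAt gs i₀
      -- g_{i₀} = ι (u − Σ_{i ≠ i₀} cᵢ gᵢ), and every other gᵢ is itself in hs
      generator : ∀ i → InSpan S hs (gs i)
      generator i with i FinP.≟ i₀
      ... | yes ≡.refl =
        span-cong {bs = hs} (≋-sym (isolate ιc≈1 (≋-trans u≈ (lc-removeAt i₀ cs gs))))
          (span-⊙ {bs = hs} Sι (span-⊖ {bs = hs} (span-generator hs zero)
                              (span-∷ {bs = removeAt gs i₀} (removeAt cs i₀ , Scs ∘ punchIn i₀ , ≋-refl))))
      ... | no i≢i₀ =
        ≡.subst (InSpan S hs ∘ gs) (punchIn-punchOut (i≢i₀ ∘ ≡.sym))
          (span-generator hs (suc (punchOut (i≢i₀ ∘ ≡.sym))))

  -- A finite subset S of F, enumerated by Fin s, and the S-vectors of length m,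
  -- enumerated by Fin (s ^ m) (coordinates written in base s).
  module Enumeration {p} {S : Carrier → Set p} {s : ℕ} (hS : HasSize S s) where
    element : Fin s → Carrier
    element = proj₁ hS

    private
      element-injective : ∀ i j → element i ≈ element j → i ≡ j
      element-injective = proj₁ (proj₂ (proj₂ hS))

    index : ∀ x → S x → Fin s
    index x x∈S = proj₁ (proj₂ (proj₂ (proj₂ hS)) x x∈S)

    element-index : ∀ x (x∈S : S x) → x ≈ element (index x x∈S)
    element-index x x∈S = proj₂ (proj₂ (proj₂ (proj₂ hS)) x x∈S)

    index-cong : ∀ {x y} (x∈S : S x) (y∈S : S y) → x ≈ y → index x x∈S ≡ index y y∈S
    index-cong x∈S y∈S x≈y =
      element-injective _ _ (trans (sym (element-index _ x∈S)) (trans x≈y (element-index _ y∈S)))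

    index-element : ∀ i (e∈S : S (element i)) → index (element i) e∈S ≡ i
    index-element i e∈S = element-injective _ _ (sym (element-index _ e∈S))

    vector : ∀ {m} → Fin (s ℕ.^ m) → V m
    vector y = element ∘ Fin.finToFun y

    vectorIndex : ∀ {m} (cs : V m) → (∀ i → S (cs i)) → Fin (s ℕ.^ m)
    vectorIndex cs cs∈S = Fin.funToFin (λ i → index (cs i) (cs∈S i))

    vector-vectorIndex : ∀ {m} (cs : V m) (cs∈S : ∀ i → S (cs i)) → cs ≈ᵥ vector (vectorIndex cs cs∈S)
    vector-vectorIndex cs cs∈S j =
      trans (element-index (cs j) (cs∈S j))
            (reflexive (≡.cong element (≡.sym (FinP.finToFun-funToFin (λ i → index (cs i) (cs∈S i)) j))))

    vectorIndex-cong : ∀ {m} {cs ds : V m} (cs∈S : ∀ i → S (cs i)) (ds∈S : ∀ i → S (ds i)) →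
      cs ≈ᵥ ds → vectorIndex cs cs∈S ≡ vectorIndex ds ds∈S
    vectorIndex-cong cs∈S ds∈S cs≈ds = funToFin-cong (λ i → index-cong (cs∈S i) (ds∈S i) (cs≈ds i))

    vectorIndex-vector : ∀ {m} (y : Fin (s ℕ.^ m)) (e∈S : ∀ i → S (vector {m} y i)) →
      vectorIndex (vector {m} y) e∈S ≡ y
    vectorIndex-vector {m} y e∈S =
      ≡.trans (funToFin-cong (λ i → index-element _ (e∈S i))) (FinP.funToFin-finToFin {m} y)

  -- Over a finite field equality is decidable; hence nonzero coefficients can be
  -- located and independence can be extended.
  module FiniteField (fld : IsField) {Q : ℕ} (hF : HasSize AllF Q) where
    open Enumeration hF
    open Spans allF-subfield

    _≟_ : ∀ x y → Dec (x ≈ y)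
    x ≟ y with index x tt FinP.≟ index y tt
    ... | yes same =
      yes (trans (element-index x tt) (trans (reflexive (≡.cong element same)) (sym (element-index y tt))))
    ... | no differ = no (differ ∘ index-cong tt tt)

    nonzeroCoefficient : ∀ {m} (cs : Fin m → Carrier) → ¬ (∀ i → cs i ≈ 0#) → ∃ λ i → ¬ (cs i ≈ 0#)
    nonzeroCoefficient {m} cs = ¬∀⟶∃¬ m _ (λ i → cs i ≟ 0#)

    independent-∷ : ∀ {n m} {bs : Fin m → V n} {x} →
      Independent AllF bs → ¬ InSpan AllF bs x → Independent AllF (x ∷ bs)
    independent-∷ {bs = bs} {x} independent x∉ cs _ lc≈0 with cs zero ≟ 0#
    ... | no c₀≉0 = ⊥-elim (x∉ (span-cong {bs = bs} (≋-sym (isolate ιc₀≈1 (≋-sym lc≈0)))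
                                 (span-⊙ {bs = bs} tt (span-⊖ {bs = bs} span-zero (cs ∘ suc , _ , ≋-refl)))))
      where
      ιc₀≈1 : inv fld (cs zero) c₀≉0 * cs zero ≈ 1#
      ιc₀≈1 = inv-left fld (cs zero) c₀≉0
    ... | yes c₀≈0 = λ { zero → c₀≈0 ; (suc i) → independent (cs ∘ suc) (λ _ → tt) tail≈0 i }
      where
      tail≈0 : lc (cs ∘ suc) bs ≈ᵥ 0ᵥ
      tail≈0 j = begin
        lc (cs ∘ suc) bs j                   ≈⟨ +-identityˡ _ ⟨
        0# + lc (cs ∘ suc) bs j              ≈⟨ +-congʳ (trans (*-congʳ c₀≈0) (zeroˡ (x j))) ⟨
        cs zero * x j + lc (cs ∘ suc) bs j   ≈⟨ lc≈0 j ⟩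
        0#                                   ∎

module Geometry {c ℓ p : Level} (F : CommutativeRing c ℓ) (K : CommutativeRing.Carrier F → Set p)
       (fld : FieldReduction.IsField F) (K-subfield : FieldReduction.IsSubfield F K)
       {q t : ℕ} (hF : FieldReduction.HasSize F (FieldReduction.AllF F) (q ℕ.^ t))
       (hK : FieldReduction.HasSize F K q)
       {n M : ℕ} (Π : Fin M → FieldReduction.V F n) (v : FieldReduction.V F n)
       (v≉0 : ¬ FieldReduction._≈ᵥ_ F v (FieldReduction.0ᵥ F)) where
  open CommutativeRing F hiding (zero)
  open FieldReduction F
  open LinearAlgebra F
  open FiniteField fld hF
  open Spans K-subfield using () renaming
    (span-zero to K-span-zero; exchange to K-exchange;
     independent-first≉0 to K-independent-first≉0; independent-notMultiple to K-independent-notMultiple)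
  open Spans allF-subfield
  module F̂ = Enumeration hF
  module K̂ = Enumeration hK
  open import Data.Vec.Functional.Relation.Binary.Equality.Setoid setoid
    using (≋-refl; ≋-sym; ≋-trans)
  open import Relation.Binary.Reasoning.Setoid setoid
  open import Algebra.Solver.Ring.NaturalCoefficients.Default commutativeSemiring
    using (solve; _:+_; _:*_; _:=_)

  Q : ℕ
  Q = q ℕ.^ t

  K-0 : K 0#
  K-0 = proj₁ (proj₂ K-subfield)

  MeetsOnlyInB : ∀ {m} → (Fin m → V n) → Set (c ⊔ ℓ ⊔ p)
  MeetsOnlyInB b = ∀ w → InSpan AllF b w → InSpan K Π w → InSpreadElt v w

  -- An F-basis of a subspace through B(P) that meets Π only in B(P): the
  -- invariant of the construction, which adds one basis vector at a time.
  Admissible : ∀ {m} → (Fin m → V n) → Set (c ⊔ ℓ ⊔ p)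
  Admissible b = Independent AllF b × MeetsOnlyInB b × InSpan AllF b v

  InSpanPlusB : ∀ {m} → (Fin m → V n) → V n → Set (c ⊔ ℓ ⊔ p)
  InSpanPlusB g w = Σ (V n) λ y → InSpan K g y × Σ Carrier λ ν → w ≈ᵥ y ⊕ ν ⊙ v

  CoveredBy : ∀ {m} → (Fin m → V n) → Set (c ⊔ ℓ ⊔ p)
  CoveredBy g = ∀ w → InSpan K Π w → InSpanPlusB g w

  -- The cone F·(⟨g⟩_K + ⟨b⟩_F): a new basis vector must avoid it.
  InCone : ∀ {m j} → (Fin m → V n) → (Fin j → V n) → V n → Set (c ⊔ ℓ ⊔ p)
  InCone g b x = Σ Carrier λ a → Σ (V n) λ y → InSpan K g y ×
                 Σ (V n) λ z → InSpan AllF b z × x ≈ᵥ a ⊙ (y ⊕ z)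

  admissible-v : Admissible (v ∷ [])
  admissible-v = independent-∷ {bs = []} (λ _ _ _ ()) v∉⟨⟩ , meets , span-generator (v ∷ []) zero
    where
    v∉⟨⟩ : ¬ InSpan AllF [] v
    v∉⟨⟩ (_ , _ , v≈0) = v≉0 v≈0
    meets : MeetsOnlyInB (v ∷ [])
    meets w (cs , _ , w≈) _ = cs zero , λ j → trans (w≈ j) (+-identityʳ _)

  extend : ∀ {m j} {g : Fin m → V n} {b : Fin j → V n} {x} →
    Admissible b → CoveredBy g → ¬ InCone g b x → Admissible (x ∷ b)
  extend {g = g} {b} {x} (independent , meets , v∈b) covered x∉cone =
    independent-∷ independent x∉b , meets′ , span-∷ v∈b
    where
    x∉b : ¬ InSpan AllF b x
    x∉b x∈b = x∉cone (1# , 0ᵥ , K-span-zero , x , x∈b ,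
                      λ j → sym (trans (*-identityˡ _) (+-identityˡ (x j))))
    -- if w = e₀x + T lies in Π with e₀ ≠ 0, then x = e₀⁻¹(y + νv − T) lies in the cone
    meets′ : MeetsOnlyInB (x ∷ b)
    meets′ w (e , _ , w≈) w∈Π with e zero ≟ 0#
    ... | yes e₀≈0 = meets w (e ∘ suc , _ , λ j → trans (w≈ j)
                               (trans (+-congʳ (trans (*-congʳ e₀≈0) (zeroˡ (x j)))) (+-identityˡ _))) w∈Π
    ... | no e₀≉0 =
      ⊥-elim (x∉cone (ι , y , y∈g , ν ⊙ v ⊖ T , span-⊖ {bs = b} (span-⊙ {bs = b} tt v∈b) T∈b , x≈))
      where
      T = lc (e ∘ suc) b
      T∈b : InSpan AllF b T
      T∈b = e ∘ suc , _ , ≋-refl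
      ι = inv fld (e zero) e₀≉0
      ιe₀≈1 : ι * e zero ≈ 1#
      ιe₀≈1 = inv-left fld (e zero) e₀≉0
      y = proj₁ (covered w w∈Π)
      y∈g = proj₁ (proj₂ (covered w w∈Π))
      ν = proj₁ (proj₂ (proj₂ (covered w w∈Π)))
      w≈y+νv = proj₂ (proj₂ (proj₂ (covered w w∈Π)))
      x≈ : x ≈ᵥ ι ⊙ (y ⊕ (ν ⊙ v ⊖ T))
      x≈ j = trans (isolate ιe₀≈1 w≈ j) (*-congˡ (trans (+-congʳ (w≈y+νv j)) (+-assoc _ _ _)))

  -- Counting: if |F|·|K|^m·|F|^{j+1} ≤ |F|^n, some vector avoids the cone.  The cone is
  -- the image of (μ, c, d) ↦ μ·(Σ cᵢgᵢ + Σ dᵢbᵢ), a map that is not injective (μ = 0).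
  coneMisses : ∀ {m j} (g : Fin m → V n) (b : Fin (suc j) → V n) →
    Q ℕ.* (q ℕ.^ m ℕ.* Q ℕ.^ suc j) ℕ.≤ Q ℕ.^ n → ∃ λ x → ¬ InCone g b x
  coneMisses {m} {j} g b size =
    let y , missed = collision⇒missesPoint code i₀≢i₁ code-i₀≡i₁ size in F̂.vector y , y∉cone missed
    where
    coneElement : Fin Q → Fin (q ℕ.^ m) → Fin (Q ℕ.^ suc j) → V n
    coneElement μ c d = F̂.element μ ⊙ (lc (K̂.vector c) g ⊕ lc (F̂.vector d) b)

    unpacked : Fin Q × Fin (q ℕ.^ m ℕ.* Q ℕ.^ suc j) → V n
    unpacked (μ , r) = uncurry (coneElement μ) (Fin.remQuot (Q ℕ.^ suc j) r)

    point : Fin (Q ℕ.* (q ℕ.^ m ℕ.* Q ℕ.^ suc j)) → V n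
    point i = unpacked (Fin.remQuot (q ℕ.^ m ℕ.* Q ℕ.^ suc j) i)

    point-combine : ∀ μ c d → point (Fin.combine μ (Fin.combine c d)) ≡ coneElement μ c d
    point-combine μ c d =
      ≡.trans (≡.cong unpacked (FinP.remQuot-combine μ (Fin.combine c d)))
              (≡.cong (uncurry (coneElement μ)) (FinP.remQuot-combine c d))

    code : Fin (Q ℕ.* (q ℕ.^ m ℕ.* Q ℕ.^ suc j)) → Fin (Q ℕ.^ n)
    code i = F̂.vectorIndex (point i) (λ _ → tt)

    -- two parameters with μ = 0 and different d give the same (zero) point
    μ₀ : Fin Q
    μ₀ = F̂.index 0# tt
    c₀ : Fin (q ℕ.^ m)
    c₀ = K̂.vectorIndex {m} (λ _ → 0#) (λ _ → K-0)
    d₀ d₁ : Fin (Q ℕ.^ suc j)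
    d₀ = F̂.vectorIndex {suc j} (λ _ → 0#) (λ _ → tt)
    d₁ = F̂.vectorIndex {suc j} (λ _ → 1#) (λ _ → tt)
    i₀ i₁ : Fin (Q ℕ.* (q ℕ.^ m ℕ.* Q ℕ.^ suc j))
    i₀ = Fin.combine μ₀ (Fin.combine c₀ d₀)
    i₁ = Fin.combine μ₀ (Fin.combine c₀ d₁)

    i₀≢i₁ : i₀ ≢ i₁
    i₀≢i₁ i₀≡i₁ = proj₁ fld (begin
      1#                  ≈⟨ F̂.vector-vectorIndex {suc j} (λ _ → 1#) (λ _ → tt) zero ⟩
      F̂.vector {suc j} d₁ zero ≡⟨ ≡.cong (λ d → F̂.vector {suc j} d zero) d₀≡d₁ ⟨
      F̂.vector {suc j} d₀ zero ≈⟨ F̂.vector-vectorIndex {suc j} (λ _ → 0#) (λ _ → tt) zero ⟨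
      0#                  ∎)
      where
      d₀≡d₁ : d₀ ≡ d₁
      d₀≡d₁ = FinP.combine-injectiveʳ c₀ d₀ c₀ d₁
                (FinP.combine-injectiveʳ μ₀ (Fin.combine c₀ d₀) μ₀ (Fin.combine c₀ d₁) i₀≡i₁)

    point≈0 : ∀ d → point (Fin.combine μ₀ (Fin.combine c₀ d)) ≈ᵥ 0ᵥ
    point≈0 d k = trans (reflexive (≡.cong (λ z → z k) (point-combine μ₀ c₀ d)))
                        (trans (*-congʳ (sym (F̂.element-index 0# tt))) (zeroˡ _))

    code-i₀≡i₁ : code i₀ ≡ code i₁
    code-i₀≡i₁ = F̂.vectorIndex-cong _ _ (≋-trans (point≈0 d₀) (≋-sym (point≈0 d₁)))

    -- every cone element is some point, so a vector whose code is missed avoids the cone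
    y∉cone : ∀ {y} → (∀ i → code i ≢ y) → ¬ InCone g b (F̂.vector y)
    y∉cone {y} missed (a , z , (cs , Kcs , z≈) , z′ , (ds , _ , z′≈) , x≈) = missed i code-i≡y
      where
      i = Fin.combine (F̂.index a tt) (Fin.combine (K̂.vectorIndex cs Kcs) (F̂.vectorIndex ds (λ _ → tt)))
      x≈point : F̂.vector y ≈ᵥ point i
      x≈point k = trans (x≈ k) (trans
        (*-cong (F̂.element-index a tt)
                (+-cong (trans (z≈ k) (lc-cong g (K̂.vector-vectorIndex cs Kcs) k))
                        (trans (z′≈ k) (lc-cong b (F̂.vector-vectorIndex ds (λ _ → tt)) k))))
        (reflexive (≡.cong (λ z → z k) (≡.sym (point-combine _ _ _)))))
      code-i≡y : code i ≡ y
      code-i≡y = ≡.trans (F̂.vectorIndex-cong _ _ (≋-sym x≈point)) (F̂.vectorIndex-vector {n} y _)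

  covered-span : ∀ {m} {g : Fin m → V n} → SpanIncl K Π g → CoveredBy g
  covered-span Π⊆g w w∈Π =
    w , Π⊆g w w∈Π , 0# , λ j → sym (trans (+-congˡ (zeroˡ (v j))) (+-identityʳ (w j)))

  covered-absorb : ∀ {m} {g : Fin m → V n} {x} → InSpreadElt v x → CoveredBy (x ∷ g) → CoveredBy g
  covered-absorb {g = g} {x} (κ , x≈κv) covered w w∈Π = absorb (covered w w∈Π)
    where
    regroup : ∀ a κ u L ν → (a * (κ * u) + L) + ν * u ≈ L + (ν + a * κ) * u
    regroup = solve 5 (λ a κ u L ν → (a :* (κ :* u) :+ L) :+ ν :* u := L :+ (ν :+ a :* κ) :* u) refl
    absorb : InSpanPlusB (x ∷ g) w → InSpanPlusB g w
    absorb (y , (cs , Kcs , y≈) , ν , w≈) =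
      lc (cs ∘ suc) g , (cs ∘ suc , Kcs ∘ suc , ≋-refl) , ν + cs zero * κ , λ j → begin
        w j                                                ≈⟨ w≈ j ⟩
        y j + ν * v j                                      ≈⟨ +-congʳ (trans (y≈ j) (+-congʳ (*-congˡ (x≈κv j)))) ⟩
        (cs zero * (κ * v j) + lc (cs ∘ suc) g j) + ν * v j ≈⟨ regroup _ _ _ _ _ ⟩
        lc (cs ∘ suc) g j + (ν + cs zero * κ) * v j         ∎

  -- If P ∈ Π, exchanging v into generators g of Π leaves one generator fewer modulo B(P).
  pointCase : ∀ {m} {g : Fin (suc m) → V n} → SpanIncl K Π g → InSpan K Π v → Σ (Fin m → V n) CoveredBy
  pointCase {g = g} Π⊆g v∈Π =
    removeAt g i₀ , covered-absorb {g = removeAt g i₀} v∈B (covered-span {g = v ∷ removeAt g i₀} Π⊆v∷g′)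
    where
    cs = proj₁ (Π⊆g v v∈Π)
    Kcs = proj₁ (proj₂ (Π⊆g v v∈Π))
    v≈ = proj₂ (proj₂ (Π⊆g v v∈Π))
    nonzero = nonzeroCoefficient cs (λ cs≈0 → v≉0 (≋-trans v≈ (lc-zero cs g cs≈0)))
    i₀ = proj₁ nonzero
    Π⊆v∷g′ : SpanIncl K Π (v ∷ removeAt g i₀)
    Π⊆v∷g′ w = K-exchange fld g cs Kcs v≈ i₀ (proj₂ nonzero) w ∘ Π⊆g w
    v∈B : InSpreadElt v v
    v∈B = 1# , λ j → sym (*-identityˡ (v j))

  -- If Π meets B(P) in a line ⟨u₀, u₁⟩_K, exchanging u₀ and then u₁ into generators g
  -- of Π leaves two generators fewer modulo B(P).
  lineCase : ∀ {m} {g : Fin (suc (suc m)) → V n} → SpanIncl K Π g →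
    (u : Fin 2 → V n) → Independent K u → (∀ i → InSpreadElt v (u i) × InSpan K Π (u i)) →
    Σ (Fin m → V n) CoveredBy
  lineCase {g = g} Π⊆g u independent u∈B∩Π =
    removeAt g₁ i₁ , covered-absorb {g = removeAt g₁ i₁} (proj₁ (u∈B∩Π zero))
                       (covered-absorb {g = removeAt (u₀ ∷ g₁) (suc i₁)} (proj₁ (u∈B∩Π (suc zero)))
                         (covered-span {g = u₁ ∷ removeAt (u₀ ∷ g₁) (suc i₁)} Π⊆u₁∷u₀∷g₂))
    where
    u₀ = u zero
    u₁ = u (suc zero)
    cs = proj₁ (Π⊆g u₀ (proj₂ (u∈B∩Π zero)))
    Kcs = proj₁ (proj₂ (Π⊆g u₀ (proj₂ (u∈B∩Π zero))))
    u₀≈ = proj₂ (proj₂ (Π⊆g u₀ (proj₂ (u∈B∩Π zero))))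
    nonzero₀ = nonzeroCoefficient cs (λ cs≈0 →
      K-independent-first≉0 (proj₁ fld) u independent (≋-trans u₀≈ (lc-zero cs g cs≈0)))
    i₀ = proj₁ nonzero₀
    g₁ = removeAt g i₀
    Π⊆u₀∷g₁ : SpanIncl K Π (u₀ ∷ g₁)
    Π⊆u₀∷g₁ w = K-exchange fld g cs Kcs u₀≈ i₀ (proj₂ nonzero₀) w ∘ Π⊆g w
    -- second exchange: u₁ is not a K-multiple of u₀, so it replaces a generator of g₁
    ds = proj₁ (Π⊆u₀∷g₁ u₁ (proj₂ (u∈B∩Π (suc zero))))
    Kds = proj₁ (proj₂ (Π⊆u₀∷g₁ u₁ (proj₂ (u∈B∩Π (suc zero)))))
    u₁≈ = proj₂ (proj₂ (Π⊆u₀∷g₁ u₁ (proj₂ (u∈B∩Π (suc zero)))))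
    nonzero₁ = nonzeroCoefficient (ds ∘ suc) (λ ds≈0 →
      K-independent-notMultiple (proj₁ fld) u independent (Kds zero)
        (λ j → trans (u₁≈ j) (trans (+-congˡ (lc-zero (ds ∘ suc) g₁ ds≈0 j)) (+-identityʳ _))))
    i₁ = proj₁ nonzero₁
    Π⊆u₁∷u₀∷g₂ : SpanIncl K Π (u₁ ∷ removeAt (u₀ ∷ g₁) (suc i₁))
    Π⊆u₁∷u₀∷g₂ w = K-exchange fld (u₀ ∷ g₁) ds Kds u₁≈ (suc i₁) (proj₂ nonzero₁) w ∘ Π⊆u₀∷g₁ w

  build : ∀ {m} {g : Fin m → V n} → CoveredBy g → ∀ j → t ℕ.+ (m ℕ.+ t ℕ.* j) ℕ.≤ t ℕ.* n →
    Σ (Fin (suc j) → V n) Admissible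
  build covered zero _ = v ∷ [] , admissible-v
  build {m} {g} covered (suc j) within =
    let b , admissible = build covered j (ℕP.≤-trans fewer within)
        x , x∉cone = coneMisses g b (powerBound q t m (suc j) n 1≤q within)
    in x ∷ b , extend {g = g} {b = b} admissible covered x∉cone
    where
    fewer : t ℕ.+ (m ℕ.+ t ℕ.* j) ℕ.≤ t ℕ.+ (m ℕ.+ t ℕ.* suc j)
    fewer = ℕP.+-monoʳ-≤ t (ℕP.+-monoʳ-≤ m (ℕP.*-monoʳ-≤ t (ℕP.n≤1+n j)))
    1≤q : 1 ℕ.≤ q
    1≤q = positive (K̂.index 0# K-0)
      where
      positive : ∀ {k} → Fin k → 1 ℕ.≤ k
      positive zero    = s≤s z≤n
      positive (suc _) = s≤s z≤n

  subspaceMeetingΠInB : ∀ {m} → Σ (Fin m → V n) CoveredBy → ∀ j → t ℕ.+ (m ℕ.+ t ℕ.* j) ℕ.≤ t ℕ.* n →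
    Σ (Fin (suc j) → V n) λ b → IsDBasis (suc j) b × MeetsOnlyInB b
  subspaceMeetingΠInB (g , covered) j within =
    let b , independent , meets , _ = build {g = g} covered j within in b , independent , meets

open import Data.Nat using (_+_; _*_; _∸_; _^_; _≤_)

-- The theorem.
lemma6 : ∀ {c ℓ p : Level} (F : CommutativeRing c ℓ) →
    let open FieldReduction F in
    (K : CommutativeRing.Carrier F → Set p) →
    (q n k t : ℕ) →
    IsPrimePower q → 1 ≤ t → 2 ≤ k → k + 1 ≤ n →
    IsField → HasSize AllF (q ^ t) → IsSubfield K → HasSize K q →
    (Π : Fin (n * t ∸ k * t + 2) → V n) → Independent K Π →
    (v : V n) → ¬ (v ≈ᵥ 0ᵥ) → InSpan K Π v →
    (Σ (Fin (k ∸ 1) → V n) λ b → IsDBasis (k ∸ 1) b ×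
       (∀ w → InSpan AllF b w → InSpan K Π w → InSpreadElt v w))
    ×
    ((Σ (Fin 2 → V n) λ u → Independent K u ×
        (∀ i → InSpreadElt v (u i) × InSpan K Π (u i))) →
     Σ (Fin k → V n) λ b → IsDBasis k b ×
       (∀ w → InSpan AllF b w → InSpan K Π w → InSpreadElt v w))
lemma6 F K q n (suc (suc k′)) t _ 1≤t (s≤s (s≤s _)) k+1≤n fld hF K-subfield hK Π _ v v≉0 v∈Π =
  pointResult , lineResult
  where
  open FieldReduction F using (V)
  open LinearAlgebra F using (SpanIncl; span-subst)
  open Geometry F K fld K-subfield {q} {t} hF hK Π v v≉0
  k = suc (suc k′)
  N = n * t ∸ k * t
  Π′ : Fin (suc (suc N)) → V n
  Π′ = ≡.subst (λ m → Fin m → V n) (ℕP.+-comm N 2) Π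
  Π⊆Π′ : SpanIncl K Π Π′
  Π⊆Π′ = span-subst {S = K} (ℕP.+-comm N 2) Π
  fullBudget : t + (N + t * suc k′) ≡ t * n
  fullBudget = budget t n (suc k′) N (ℕP.m∸n+n≡m (ℕP.*-monoˡ-≤ t (ℕP.≤-trans (ℕP.m≤m+n k 1) k+1≤n)))
  -- P ∈ Π: a D_{k-2}-subspace, built on N + 1 remaining generators
  pointResult = subspaceMeetingΠInB (pointCase {g = Π′} Π⊆Π′ v∈Π) k′
                  (ℕP.≤-trans (budget-shift t N k′ 1≤t) (ℕP.≤-reflexive fullBudget))
  -- a line of B(P) in Π: a D_{k-1}-subspace, built on N remaining generators
  lineResult = λ (u , independent , u∈B∩Π) →
    subspaceMeetingΠInB (lineCase {g = Π′} Π⊆Π′ u independent u∈B∩Π) (suc k′) (ℕP.≤-reflexive fullBudget)
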